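{- If $|A|=1$, then the inequational theory of BCCS($A$) modulo $\precsim_{\rm WIF}$ does not have a finite basis; that is, there is no finite inequational axiomatization over BCCS($A$) that is sound modulo $\precsim_{\rm WIF}$, ground-complete for BCCS($A$) modulo $\precsim_{\rm WIF}$, and $\omega$-complete.
   Context: $A$ is a nonempty set of actions, $\tau\notin A$, $A_\tau=A\cup\{\tau\}$. BCCS($A$) terms: $t::=0\mid x\mid\alpha t\mid t+t$ ($x$ a variable, $\alpha\in A_\tau$). Transitions: $\alpha t\xrightarrow{\alpha}t$; if $t\xrightarrow{\alpha}t'$ then $t+u\xrightarrow{\alpha}t'$ and $u+t\xrightarrow{\alpha}t'$. $\Rightarrow$ is the reflexive-transitive closure of $\xrightarrow{\tau}$. $a_1\cdots a_k\in A^*$ is a weak trace of closed $s$ if $s\Rightarrow\xrightarrow{a_1}\Rightarrow\cdots\xrightarrow{a_k}\Rightarrow s'$; $\mathcal{WT}(s)$ the set. $(a_1\cdots a_k,B)$, $B\subseteq A^*$, is a weak impossible future of $s$ if $s\Rightarrow\xrightarrow{a_1}\Rightarrow\cdots\xrightarrow{a_k}\Rightarrow s'$ with $\mathcal{WT}(s')\cap B=\emptyset$. $s_1\precsim_{\rm WIF}s_2$ iff weak impossible futures of $s_1$ are those of $s_2$, $\mathcal{WT}(s_1)=\mathcal{WT}(s_2)$, and $s_1\xrightarrow{\tau}$ implies $s_2\xrightarrow{\tau}$; on open terms via all closed substitutions. Inequational logic: reflexivity, transitivity, substitution instances, closure under contexts. Sound: every derivable inequation holds modulo $\precsim_{\rm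 WIF}$; ground-complete: closed $p\precsim_{\rm WIF}q$ implies $p\preccurlyeq q$ derivable; $\omega$-complete: if all closed instances of $t\preccurlyeq u$ are derivable, then so is $t\preccurlyeq u$. -}

module Defs where

open import Data.Nat using (ℕ)
open import Data.List using (List; []; _∷_)
open import Data.List.Membership.Propositional using (_∈_)
open import Data.Product using (Σ; ∃; _×_; _,_)
open import Data.Empty using (⊥)
open import Relation.Nullary using (¬_)
open import Relation.Binary.PropositionalEquality using (_≡_)
open import Relation.Binary.Construct.Closure.ReflexiveTransitive using (Star)

data Actτ (A : Set) : Set where
  τ   : Actτ A
  act : A → Actτ A

data Term (A : Set) : Set where
  𝟘   : Term A
  var : ℕ → Term A
  _·_ : Actτ A → Term A → Term A
  _⊕_ : Term A → Term A → Term A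

infixr 7 _·_
infixl 6 _⊕_

data Closed {A : Set} : Term A → Set where
  c𝟘 : Closed 𝟘
  c· : ∀ {α t} → Closed t → Closed (α · t)
  c⊕ : ∀ {t u} → Closed t → Closed u → Closed (t ⊕ u)

Subst : Set → Set
Subst A = ℕ → Term A

ClosedSubst : {A : Set} → Subst A → Set
ClosedSubst σ = ∀ x → Closed (σ x)

_[_] : {A : Set} → Term A → Subst A → Term A
𝟘 [ σ ] = 𝟘
var x [ σ ] = σ x
(α · t) [ σ ] = α · (t [ σ ])
(t ⊕ u) [ σ ] = (t [ σ ]) ⊕ (u [ σ ])

data _─[_]→_ {A : Set} : Term A → Actτ A → Term A → Set where
  pre  : ∀ {α t} → (α · t) ─[ α ]→ t
  sumˡ : ∀ {t u α t'} → t ─[ α ]→ t' → (t ⊕ u) ─[ α ]→ t'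
  sumʳ : ∀ {t u α t'} → t ─[ α ]→ t' → (u ⊕ t) ─[ α ]→ t'

_τ→_ : {A : Set} → Term A → Term A → Set
s τ→ s' = s ─[ τ ]→ s'

_⇒_ : {A : Set} → Term A → Term A → Set
_⇒_ = Star _τ→_

data _=[_]⇒_ {A : Set} : Term A → List A → Term A → Set where
  done : ∀ {s s'} → s ⇒ s' → s =[ [] ]⇒ s'
  step : ∀ {s s₁ s₂ s' a w} → s ⇒ s₁ → s₁ ─[ act a ]→ s₂ → s₂ =[ w ]⇒ s' →
         s =[ a ∷ w ]⇒ s'

WT : {A : Set} → Term A → List A → Set
WT s w = ∃ λ s' → s =[ w ]⇒ s'

WIF : {A : Set} → Term A → List A → (List A → Set) → Set
WIF s w B = ∃ λ s' → s =[ w ]⇒ s' × (∀ v → WT s' v → B v → ⊥)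

HasTau : {A : Set} → Term A → Set
HasTau s = ∃ λ s' → s ─[ τ ]→ s'

_≾WIF_ : {A : Set} → Term A → Term A → Set₁
s₁ ≾WIF s₂ =
  (∀ w B → WIF s₁ w B → WIF s₂ w B) ×
  ((∀ w → WT s₁ w → WT s₂ w) × (∀ w → WT s₂ w → WT s₁ w)) ×
  (HasTau s₁ → HasTau s₂)

_≾WIFᵒ_ : {A : Set} → Term A → Term A → Set₁
t ≾WIFᵒ u = ∀ σ → ClosedSubst σ → (t [ σ ]) ≾WIF (u [ σ ])

Axioms : Set → Set
Axioms A = List (Term A × Term A)

data _⊢_≼_ {A : Set} (E : Axioms A) : Term A → Term A → Set where
  ax    : ∀ {t u} → (t , u) ∈ E → E ⊢ t ≼ u
  refl  : ∀ {t} → E ⊢ t ≼ t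
  trans : ∀ {t u v} → E ⊢ t ≼ u → E ⊢ u ≼ v → E ⊢ t ≼ v
  subst : ∀ {t u} (σ : Subst A) → E ⊢ t ≼ u → E ⊢ (t [ σ ]) ≼ (u [ σ ])
  ctx·  : ∀ {t u} (α : Actτ A) → E ⊢ t ≼ u → E ⊢ (α · t) ≼ (α · u)
  ctx⊕  : ∀ {t₁ u₁ t₂ u₂} → E ⊢ t₁ ≼ u₁ → E ⊢ t₂ ≼ u₂ →
          E ⊢ (t₁ ⊕ t₂) ≼ (u₁ ⊕ u₂)

Sound : {A : Set} → Axioms A → Set₁
Sound E = ∀ t u → E ⊢ t ≼ u → t ≾WIFᵒ u

GroundComplete : {A : Set} → Axioms A → Set₁
GroundComplete E = ∀ p q → Closed p → Closed q → p ≾WIF q → E ⊢ p ≼ q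

OmegaComplete : {A : Set} → Axioms A → Set
OmegaComplete E = ∀ t u → (∀ σ → ClosedSubst σ → E ⊢ (t [ σ ]) ≼ (u [ σ ])) → E ⊢ t ≼ u

ExactlyOne : Set → Set
ExactlyOne A = Σ A λ a → ∀ b → b ≡ a

module Submission where

-- Let E be finite and sound, and let D be the largest depth (number of
-- visible actions along a path) of a left-hand side of an axiom of E.  For
-- n > D, E cannot derive  aⁿx ≼ aⁿx + x  (`no-sound-derivation`): unfold a
-- derivation into single rewrite steps and take the first step t ⟶ t' that
-- makes x unguarded (`first-crossing`).  Soundness of the axiom applied forces
-- x to occur in t at depth at most D (`occurs-in-lhs`, `crossing-step`), and
-- not at depth 0 as x is still guarded in t.  But no t ≾WIF aⁿx + x has x at
-- a depth between 1 and n - 1: substituting x := a0 + aⁿa0 gives t a weak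
-- impossible future that aⁿx + x lacks (`no-shallow-occurrence`).
--
-- All of this holds for arbitrary A (given one action a).  Only the last
-- step uses |A| = 1: then every trace of p is a trace of aⁿp, so all closed
-- instances of aⁿx ≼ aⁿx + x are valid (`absorb`, `valid`), hence derivable by
-- ground-completeness, and aⁿx ≼ aⁿx + x itself is derivable by
-- ω-completeness (`family-derivable`), contradicting the above for n = D + 1.

open import Defs
open import Data.Product using (Σ; _×_; _,_; proj₁; proj₂)
open import Data.Sum using (_⊎_; inj₁; inj₂; [_,_])
open import Data.Empty using (⊥; ⊥-elim)
open import Function using (id)
open import Relation.Nullary using (¬_; yes; no; Dec)
open import Relation.Unary using (Decidable)
open import Data.Nat using (ℕ; zero; suc; _≤_; _<_; z≤n; s≤s; _⊔_; _≟_)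
open import Data.Nat.Properties
  using (m≤m⊔n; m≤n⊔m; ≤-refl; ≤-trans; ≤-reflexive; +-comm; 1+n≰n)
open import Data.List using (List; []; _∷_; _++_; length; replicate)
open import Data.List.Properties using (++-identityʳ; ++-conicalʳ; length-++; length-replicate)
open import Data.List.Membership.Propositional using (_∈_)
open import Data.List.Relation.Unary.Any using (here; there)
open import Relation.Binary.PropositionalEquality
  using (_≡_; _≢_; refl; sym; cong; cong₂; subst₂; module ≡-Reasoning)
  renaming (trans to ≡-trans; subst to ≡-subst)
open import Relation.Binary.Construct.Closure.ReflexiveTransitive
  using (Star; ε; _◅_; _◅◅_; gmap)

first-crossing : ∀ {X : Set} {R : X → X → Set} {P : X → Set} → Decidable P →
  ∀ {s u} → Star R s u → ¬ P s → P u →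
  Σ X λ t → Σ X λ t' → R t t' × ¬ P t × P t' × Star R t' u
first-crossing P? ε ¬Ps Pu = ⊥-elim (¬Ps Pu)
first-crossing P? {s} (_◅_ {j = m} r rs) ¬Ps Pu with P? m
... | yes Pm = s , m , r , ¬Ps , Pm , rs
... | no ¬Pm = first-crossing P? rs ¬Pm Pu

module _ {A : Set} where

  private variable
    s s' t u q p l r : Term A
    w π π' : List A
    b c : A
    x y : ℕ
    σ : Subst A
    E : Axioms A

  Stable : Term A → Set
  Stable t = ∀ {s' : Term A} → ¬ (t ─[ τ ]→ s')

  run-⊕ˡ : s =[ w ]⇒ s' → w ≢ [] → (s ⊕ u) =[ w ]⇒ s'
  run-⊕ˡ (done _) w≢[] = ⊥-elim (w≢[] refl)
  run-⊕ˡ (step ε tr r) _ = step ε (sumˡ tr) r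
  run-⊕ˡ (step (x ◅ xs) tr r) _ = step (sumˡ x ◅ xs) tr r

  run-⊕ʳ : s =[ w ]⇒ s' → w ≢ [] → (u ⊕ s) =[ w ]⇒ s'
  run-⊕ʳ (done _) w≢[] = ⊥-elim (w≢[] refl)
  run-⊕ʳ (step ε tr r) _ = step ε (sumʳ tr) r
  run-⊕ʳ (step (x ◅ xs) tr r) _ = step (sumʳ x ◅ xs) tr r

  run-⊕-split : (t ⊕ u) =[ b ∷ w ]⇒ s' →
    t =[ b ∷ w ]⇒ s' ⊎ u =[ b ∷ w ]⇒ s'
  run-⊕-split (step ε (sumˡ tr) r) = inj₁ (step ε tr r)
  run-⊕-split (step ε (sumʳ tr) r) = inj₂ (step ε tr r)
  run-⊕-split (step (sumˡ x ◅ xs) tr r) = inj₁ (step (x ◅ xs) tr r)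
  run-⊕-split (step (sumʳ x ◅ xs) tr r) = inj₂ (step (x ◅ xs) tr r)

  run-τ· : t =[ w ]⇒ s' → (τ · t) =[ w ]⇒ s'
  run-τ· (done xs) = done (pre ◅ xs)
  run-τ· (step xs tr r) = step (pre ◅ xs) tr r

  run-act· : (act b · t) =[ c ∷ w ]⇒ s' → t =[ w ]⇒ s'
  run-act· (step ε pre r) = r
  run-act· (step (() ◅ _) _ _)

  run-𝟘 : 𝟘 =[ w ]⇒ s → w ≡ []
  run-𝟘 (done _) = refl
  run-𝟘 (step ε () _)
  run-𝟘 (step (() ◅ _) _ _)

  run-stable : Stable t → t =[ [] ]⇒ s' → s' ≡ t
  run-stable _ (done ε) = refl
  run-stable stable (done (x ◅ _)) = ⊥-elim (stable x)

  WT-prefix : ∀ v w → WT s (v ++ w) → WT s v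
  WT-prefix [] w _ = _ , done ε
  WT-prefix (b ∷ v) w (_ , step xs tr r) with WT-prefix v w (_ , r)
  ... | s'' , r' = s'' , step xs tr r'

  WT-⊕ˡ : ∀ w → WT t w → WT (t ⊕ u) w
  WT-⊕ˡ [] _ = _ , done ε
  WT-⊕ˡ (b ∷ w) (s , r) = s , run-⊕ˡ r (λ ())

  WT-⊕ : ∀ w → WT (t ⊕ u) w → WT t w ⊎ WT u w
  WT-⊕ [] _ = inj₁ (_ , done ε)
  WT-⊕ (b ∷ w) (s , r) with run-⊕-split r
  ... | inj₁ r' = inj₁ (s , r')
  ... | inj₂ r' = inj₂ (s , r')

  absorb : (∀ v → WT p v → WT q v) → q ≾WIF (q ⊕ p)
  absorb {p = p} {q = q} p⊆q = wif , (WT-⊕ˡ , traces-back) , λ (s , tr) → s , sumˡ tr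
    where
    traces-back : ∀ v → WT (q ⊕ p) v → WT q v
    traces-back v wt = [ id , p⊆q v ] (WT-⊕ v wt)
    wif : ∀ w B → WIF q w B → WIF (q ⊕ p) w B
    wif [] B (_ , done ε , nb) = q ⊕ p , done ε , λ v wt → nb v (traces-back v wt)
    wif [] B (s , done (x ◅ xs) , nb) = s , done (sumˡ x ◅ xs) , nb
    wif (b ∷ w) B (s , r , nb) = s , run-⊕ˡ r (λ ()) , nb

  -- Occurrences and depth

  -- Occ x t π : x occurs in t below the visible actions π
  -- (τ-prefixes and summations are transparent).
  data Occ (x : ℕ) : Term A → List A → Set where
    o-var : Occ x (var x) []
    o-τ   : ∀ {t π} → Occ x t π → Occ x (τ · t) π
    o-act : ∀ {t π} b → Occ x t π → Occ x (act b · t) (b ∷ π)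
    o-⊕ˡ  : ∀ {t t' π} → Occ x t π → Occ x (t ⊕ t') π
    o-⊕ʳ  : ∀ {t t' π} → Occ x t' π → Occ x (t ⊕ t') π

  Unguarded : ℕ → Term A → Set
  Unguarded x t = Occ x t []

  unguarded? : ∀ x → Decidable (Unguarded x)
  unguarded? x 𝟘 = no λ ()
  unguarded? x (var z) with z ≟ x
  ... | yes refl = yes o-var
  ... | no z≢x = no λ { o-var → z≢x refl }
  unguarded? x (τ · t) with unguarded? x t
  ... | yes o = yes (o-τ o)
  ... | no ¬o = no λ { (o-τ o) → ¬o o }
  unguarded? x (act b · t) = no λ ()
  unguarded? x (t ⊕ t') with unguarded? x t | unguarded? x t'
  ... | yes o | _ = yes (o-⊕ˡ o)
  ... | no _ | yes o = yes (o-⊕ʳ o)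
  ... | no ¬o | no ¬o' = no λ { (o-⊕ˡ o) → ¬o o ; (o-⊕ʳ o) → ¬o' o }

  depth : Term A → ℕ
  depth 𝟘 = 0
  depth (var _) = 0
  depth (τ · t) = depth t
  depth (act _ · t) = suc (depth t)
  depth (t ⊕ u) = depth t ⊔ depth u

  occ-depth : Occ x t π → length π ≤ depth t
  occ-depth o-var = z≤n
  occ-depth (o-τ o) = occ-depth o
  occ-depth (o-act b o) = s≤s (occ-depth o)
  occ-depth (o-⊕ˡ {t} {t'} o) = ≤-trans (occ-depth o) (m≤m⊔n (depth t) (depth t'))
  occ-depth (o-⊕ʳ {t} {t'} o) = ≤-trans (occ-depth o) (m≤n⊔m (depth t) (depth t'))

  occ-run : Occ y t π → σ y =[ w ]⇒ q → w ≢ [] →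
    (t [ σ ]) =[ π ++ w ]⇒ q
  occ-run o-var r _ = r
  occ-run (o-τ o) r w≢[] = run-τ· (occ-run o r w≢[])
  occ-run (o-act b o) r w≢[] = step ε pre (occ-run o r w≢[])
  occ-run {π = π} {w = w} (o-⊕ˡ o) r w≢[] =
    run-⊕ˡ (occ-run o r w≢[]) (λ eq → w≢[] (++-conicalʳ π w eq))
  occ-run {π = π} {w = w} (o-⊕ʳ o) r w≢[] =
    run-⊕ʳ (occ-run o r w≢[]) (λ eq → w≢[] (++-conicalʳ π w eq))

  occ-∘ : Occ y t π → Occ x (σ y) π' → Occ x (t [ σ ]) (π ++ π')
  occ-∘ o-var o' = o'
  occ-∘ (o-τ o) o' = o-τ (occ-∘ o o')
  occ-∘ (o-act b o) o' = o-act b (occ-∘ o o')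
  occ-∘ (o-⊕ˡ o) o' = o-⊕ˡ (occ-∘ o o')
  occ-∘ (o-⊕ʳ o) o' = o-⊕ʳ (occ-∘ o o')

  unguarded-[] : ∀ t σ → Unguarded x (t [ σ ]) →
    Σ ℕ λ y → Unguarded y t × Unguarded x (σ y)
  unguarded-[] 𝟘 σ ()
  unguarded-[] (var y) σ o = y , o-var , o
  unguarded-[] (τ · t) σ (o-τ o) with unguarded-[] t σ o
  ... | y , oy , ox = y , o-τ oy , ox
  unguarded-[] (act b · t) σ ()
  unguarded-[] (t ⊕ t') σ (o-⊕ˡ o) with unguarded-[] t σ o
  ... | y , oy , ox = y , o-⊕ˡ oy , ox
  unguarded-[] (t ⊕ t') σ (o-⊕ʳ o) with unguarded-[] t' σ o
  ... | y , oy , ox = y , o-⊕ʳ oy , ox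

  data RunSplit (t : Term A) (σ : Subst A) (w : List A) (s' : Term A) : Set where
    inside  : length w ≤ depth t → RunSplit t σ w s'
    through : ∀ z π w' → Occ z t π → σ z =[ w' ]⇒ s' → w ≡ π ++ w' → RunSplit t σ w s'

  run-split : ∀ t σ {w s'} → (t [ σ ]) =[ w ]⇒ s' → RunSplit t σ w s'
  run-split t σ (done _) = inside z≤n
  run-split (var z) σ r = through z [] _ o-var r refl
  run-split 𝟘 σ (step ε () _)
  run-split 𝟘 σ (step (() ◅ _) _ _)
  run-split (τ · t) σ (step ε () _)
  run-split (τ · t) σ (step (pre ◅ xs) tr r) with run-split t σ (step xs tr r)
  ... | inside le = inside le
  ... | through z π w' o r' eq = through z π w' (o-τ o) r' eq
  run-split (act b · t) σ (step ε pre r) with run-split t σ r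
  ... | inside le = inside (s≤s le)
  ... | through z π w' o r' eq = through z (b ∷ π) w' (o-act b o) r' (cong (b ∷_) eq)
  run-split (act b · t) σ (step (() ◅ _) _ _)
  run-split (t ⊕ t') σ {w} {s'} (step xs tr r) = summand (run-⊕-split (step xs tr r))
    where
    summand : (t [ σ ]) =[ w ]⇒ s' ⊎ (t' [ σ ]) =[ w ]⇒ s' → RunSplit (t ⊕ t') σ w s'
    summand (inj₁ r₁) with run-split t σ r₁
    ... | inside le = inside (≤-trans le (m≤m⊔n (depth t) (depth t')))
    ... | through z π w' o r' eq = through z π w' (o-⊕ˡ o) r' eq
    summand (inj₂ r₂) with run-split t' σ r₂
    ... | inside le = inside (≤-trans le (m≤n⊔m (depth t) (depth t')))
    ... | through z π w' o r' eq = through z π w' (o-⊕ʳ o) r' eq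

  []-∘ : ∀ (t : Term A) σ ρ → (t [ σ ]) [ ρ ] ≡ t [ (λ z → σ z [ ρ ]) ]
  []-∘ 𝟘 σ ρ = refl
  []-∘ (var x) σ ρ = refl
  []-∘ (α · t) σ ρ = cong (α ·_) ([]-∘ t σ ρ)
  []-∘ (t ⊕ u) σ ρ = cong₂ _⊕_ ([]-∘ t σ ρ) ([]-∘ u σ ρ)

  []-var : ∀ (t : Term A) → t [ var ] ≡ t
  []-var 𝟘 = refl
  []-var (var x) = refl
  []-var (α · t) = cong (α ·_) ([]-var t)
  []-var (t ⊕ u) = cong₂ _⊕_ ([]-var t) ([]-var u)

  pick : ℕ → Term A → Subst A
  pick y p z with z ≟ y
  ... | yes _ = p
  ... | no _ = 𝟘

  pick-hit : ∀ y p → pick y p y ≡ p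
  pick-hit y p with y ≟ y
  ... | yes _ = refl
  ... | no y≢y = ⊥-elim (y≢y refl)

  pick-miss : ∀ {y z : ℕ} p → z ≢ y → pick y p z ≡ 𝟘
  pick-miss {y} {z} p z≢y with z ≟ y
  ... | yes z≡y = ⊥-elim (z≢y z≡y)
  ... | no _ = refl

  pick-closed : ∀ y {p} → Closed p → ClosedSubst (pick y p)
  pick-closed y c z with z ≟ y
  ... | yes _ = c
  ... | no _ = c𝟘

  -- Derivations as rewrite sequences: one application of an axiom
  -- instance inside a context
  data Rewrite (E : Axioms A) : Term A → Term A → Set where
    axiom : ∀ {l r} → (l , r) ∈ E → ∀ σ → Rewrite E (l [ σ ]) (r [ σ ])
    under : ∀ {t u} α → Rewrite E t u → Rewrite E (α · t) (α · u)
    left  : ∀ {t u} v → Rewrite E t u → Rewrite E (t ⊕ v) (u ⊕ v)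
    right : ∀ {t u} v → Rewrite E t u → Rewrite E (v ⊕ t) (v ⊕ u)

  rewrite-[] : Rewrite E t u → ∀ ρ → Rewrite E (t [ ρ ]) (u [ ρ ])
  rewrite-[] (axiom {l} {r} m σ) ρ =
    subst₂ (Rewrite _) (sym ([]-∘ l σ ρ)) (sym ([]-∘ r σ ρ)) (axiom m (λ z → σ z [ ρ ]))
  rewrite-[] (under α s) ρ = under α (rewrite-[] s ρ)
  rewrite-[] (left v s) ρ = left (v [ ρ ]) (rewrite-[] s ρ)
  rewrite-[] (right v s) ρ = right (v [ ρ ]) (rewrite-[] s ρ)

  derivation→rewrites : E ⊢ t ≼ u → Star (Rewrite E) t u
  derivation→rewrites (ax {t} {u} m) = subst₂ (Star (Rewrite _)) ([]-var t) ([]-var u) (axiom m var ◅ ε)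
  derivation→rewrites refl = ε
  derivation→rewrites (trans d e) = derivation→rewrites d ◅◅ derivation→rewrites e
  derivation→rewrites (subst σ d) = gmap (_[ σ ]) (λ s → rewrite-[] s σ) (derivation→rewrites d)
  derivation→rewrites (ctx· α d) = gmap (α ·_) (under α) (derivation→rewrites d)
  derivation→rewrites (ctx⊕ {t₁} {u₁} {t₂} {u₂} d e) =
    gmap (_⊕ t₂) (left t₂) (derivation→rewrites d) ◅◅ gmap (u₁ ⊕_) (right u₁) (derivation→rewrites e)

  rewrite→derivation : Rewrite E t u → E ⊢ t ≼ u
  rewrite→derivation (axiom m σ) = subst σ (ax m)
  rewrite→derivation (under α s) = ctx· α (rewrite→derivation s)
  rewrite→derivation (left v s) = ctx⊕ (rewrite→derivation s) refl
  rewrite→derivation (right v s) = ctx⊕ refl (rewrite→derivation s)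

  rewrites→derivation : Star (Rewrite E) t u → E ⊢ t ≼ u
  rewrites→derivation ε = refl
  rewrites→derivation (s ◅ ss) = trans (rewrite→derivation s) (rewrites→derivation ss)

  lhs-depth : Axioms A → ℕ
  lhs-depth [] = 0
  lhs-depth ((l , r) ∷ E) = depth l ⊔ lhs-depth E

  lhs-depth-∈ : (l , r) ∈ E → depth l ≤ lhs-depth E
  lhs-depth-∈ {E = (l , r) ∷ E} (here refl) = m≤m⊔n (depth l) (lhs-depth E)
  lhs-depth-∈ {E = (l' , r') ∷ E} (there m) = ≤-trans (lhs-depth-∈ m) (m≤n⊔m (depth l') (lhs-depth E))

module WithAction {A : Set} (a : A) where

  open ≡-Reasoning

  private variable
    s t t' l r : Term A
    x y : ℕ
    E : Axioms A

  pow : ℕ → Term A → Term A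
  pow zero t = t
  pow (suc n) t = act a · pow n t

  pow-[] : ∀ n t σ → pow n t [ σ ] ≡ pow n (t [ σ ])
  pow-[] zero t σ = refl
  pow-[] (suc n) t σ = cong (act a ·_) (pow-[] n t σ)

  pow-closed : ∀ n → Closed t → Closed (pow n t)
  pow-closed zero c = c
  pow-closed (suc n) c = c· (pow-closed n c)

  pow-run : ∀ n t → pow n t =[ replicate n a ]⇒ t
  pow-run zero t = done ε
  pow-run (suc n) t = step ε pre (pow-run n t)

  pow-stable : ∀ n → Stable t → Stable (pow n t)
  pow-stable zero stable = stable
  pow-stable (suc n) stable ()

  CanA : Term A → Set
  CanA s = WT s (a ∷ [])

  pow-canA : ∀ n → CanA t → CanA (pow n t)
  pow-canA zero canA = canA
  pow-canA (suc n) canA = _ , step ε pre (done ε)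

  pow-after : ∀ n w → length w ≤ n → Stable t → CanA t → pow n t =[ w ]⇒ s → CanA s
  pow-after n [] _ stable canA r rewrite run-stable (pow-stable n stable) r = pow-canA n canA
  pow-after (suc n) (b ∷ w) (s≤s le) stable canA r = pow-after n w le stable canA (run-act· r)

  -- Soundness lets no variable appear unguarded on the right that is absent
  -- on the left: substituting a long chain of a's for y produces a trace of
  -- r[σ] that l[σ] can only match by running through an occurrence of y.
  occurs-in-lhs : l ≾WIFᵒ r → Unguarded y r → Σ (List A) (Occ y l)
  occurs-in-lhs {l = l} {y = y} l≾r oy = from-split (run-split l σ (proj₂ trace-l))
    where
    M : ℕ
    M = depth l
    σ : Subst A
    σ = pick y (pow (suc M) 𝟘)
    run-y : σ y =[ replicate (suc M) a ]⇒ 𝟘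
    run-y rewrite pick-hit y (pow (suc M) 𝟘) = pow-run (suc M) 𝟘
    trace-l : WT (l [ σ ]) (replicate (suc M) a)
    trace-l = proj₂ (proj₁ (proj₂ (l≾r σ (pick-closed y (pow-closed (suc M) c𝟘)))))
                (replicate (suc M) a) (𝟘 , occ-run oy run-y (λ ()))
    too-long : length (replicate (suc M) a) ≤ M → ⊥
    too-long le = 1+n≰n (≡-subst (_≤ M) (length-replicate (suc M)) le)
    from-split : RunSplit l σ (replicate (suc M) a) (proj₁ trace-l) → Σ (List A) (Occ y l)
    from-split (inside le) = ⊥-elim (too-long le)
    from-split (through z π w' o r' eq) = by-cases (z ≟ y)
      where
      by-cases : Dec (z ≡ y) → Σ (List A) (Occ y l)
      by-cases (yes refl) = π , o
      by-cases (no z≢y) = ⊥-elim (too-long (≡-subst (_≤ M) (sym length-eq) (occ-depth o)))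
        where
        w'≡[] : w' ≡ []
        w'≡[] = run-𝟘 (≡-subst (_=[ w' ]⇒ proj₁ trace-l) (pick-miss (pow (suc M) 𝟘) z≢y) r')
        length-eq : length (replicate (suc M) a) ≡ length π
        length-eq = begin
          length (replicate (suc M) a)  ≡⟨ cong length eq ⟩
          length (π ++ w')              ≡⟨ cong (λ w → length (π ++ w)) w'≡[] ⟩
          length (π ++ [])              ≡⟨ cong length (++-identityʳ π) ⟩
          length π                      ∎

  crossing-step : Sound E → Rewrite E t t' → ¬ Unguarded x t → Unguarded x t' →
    Σ (List A) λ π → Occ x t π × length π ≤ lhs-depth E
  crossing-step {E = E} sound (axiom {l} {r} m σ) _ ox with unguarded-[] r σ ox
  ... | y , oy , ox' with occurs-in-lhs {l = l} (sound l r (ax m)) oy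
  ...   | π , ol = π ++ [] , occ-∘ ol ox' , bound
    where
    bound : length (π ++ []) ≤ lhs-depth E
    bound = ≤-trans (≤-reflexive (cong length (++-identityʳ π)))
                    (≤-trans (occ-depth ol) (lhs-depth-∈ m))
  crossing-step sound (under τ st) ¬ox (o-τ ox) with crossing-step sound st (λ o → ¬ox (o-τ o)) ox
  ... | π , o , le = π , o-τ o , le
  crossing-step sound (under (act b) st) _ ()
  crossing-step sound (left v st) ¬ox (o-⊕ˡ ox) with crossing-step sound st (λ o → ¬ox (o-⊕ˡ o)) ox
  ... | π , o , le = π , o-⊕ˡ o , le
  crossing-step sound (left v st) ¬ox (o-⊕ʳ ox) = ⊥-elim (¬ox (o-⊕ʳ ox))
  crossing-step sound (right v st) ¬ox (o-⊕ʳ ox) with crossing-step sound st (λ o → ¬ox (o-⊕ʳ o)) ox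
  ... | π , o , le = π , o-⊕ʳ o , le
  crossing-step sound (right v st) ¬ox (o-⊕ˡ ox) = ⊥-elim (¬ox (o-⊕ˡ ox))

  a0 : Term A
  a0 = act a · 𝟘

  witness : ℕ → Term A
  witness n = a0 ⊕ pow n a0

  witness-closed : ∀ n → Closed (witness n)
  witness-closed n = c⊕ (c· c𝟘) (pow-closed n (c· c𝟘))

  witness-run : ∀ n → witness n =[ a ∷ [] ]⇒ 𝟘
  witness-run n = run-⊕ˡ (step ε pre (done ε)) (λ ())

  witness-stable : ∀ n → Stable (witness n)
  witness-stable n (sumˡ ())
  witness-stable n (sumʳ tr) = pow-stable n (λ ()) tr

  witness-after : ∀ n b w → w ≢ [] → length w < n →
    (pow n (witness n) ⊕ witness n) =[ b ∷ w ]⇒ s → CanA s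
  witness-after n b w w≢[] lt r with run-⊕-split r
  ... | inj₁ r₁ = pow-after n (b ∷ w) lt (witness-stable n) (_ , witness-run n) r₁
  ... | inj₂ r₂ with run-⊕-split r₂
  ...   | inj₁ r₃ = ⊥-elim (w≢[] (run-𝟘 (run-act· r₃)))
  ...   | inj₂ r₃ = pow-after n (b ∷ w) lt (λ ()) (_ , step ε pre (done ε)) r₃

  -- No t ≾ aⁿx + x contains x at a depth between 1 and n - 1: with
  -- x := Pₙ, t can reach 0 after a trace of length ≤ n (an impossible future
  -- refusing a), while aⁿPₙ + Pₙ cannot refuse a after such a trace.
  no-shallow-occurrence : ∀ n → t ≾WIFᵒ (pow n (var x) ⊕ var x) →
    ∀ b π → Occ x t (b ∷ π) → length (b ∷ π) < n → ⊥
  no-shallow-occurrence {t = t} {x = x} n t≾u b π o lt =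
    no-future-of-u (proj₁ t≾u[σ] _ RefusesA future-t)
    where
    σ : Subst A
    σ _ = witness n
    t≾u[σ] : (t [ σ ]) ≾WIF (pow n (witness n) ⊕ witness n)
    t≾u[σ] = ≡-subst (λ u → (t [ σ ]) ≾WIF (u ⊕ witness n)) (pow-[] n (var x) σ)
               (t≾u σ (λ _ → witness-closed n))
    RefusesA : List A → Set
    RefusesA v = v ≡ a ∷ []
    𝟘-refuses-a : ∀ v → WT 𝟘 v → RefusesA v → ⊥
    𝟘-refuses-a _ (_ , r) refl with run-𝟘 r
    ... | ()
    future-t : WIF (t [ σ ]) (b ∷ π ++ a ∷ []) RefusesA
    future-t = 𝟘 , occ-run o (witness-run n) (λ ()) , 𝟘-refuses-a
    nonempty : π ++ a ∷ [] ≢ []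
    nonempty eq with ++-conicalʳ π (a ∷ []) eq
    ... | ()
    bound : length (π ++ a ∷ []) < n
    bound = ≡-subst (_< n) (sym (≡-trans (length-++ π) (+-comm (length π) 1))) lt
    no-future-of-u : WIF (pow n (witness n) ⊕ witness n) (b ∷ π ++ a ∷ []) RefusesA → ⊥
    no-future-of-u (_ , run-u , refuses-a) =
      refuses-a (a ∷ []) (witness-after n b (π ++ a ∷ []) nonempty bound run-u) refl

  -- A sound system cannot derive aⁿx ≼ aⁿx + x once n exceeds the depth
  -- of every left-hand side: look at the first rewrite step making x unguarded.
  no-sound-derivation : ∀ {n} → Sound E → E ⊢ pow n (var x) ≼ (pow n (var x) ⊕ var x) →
    lhs-depth E < n → ⊥
  no-sound-derivation {E = E} {x = x} {n = suc m} sound derivation shallow =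
    at-crossing (first-crossing (unguarded? x) (derivation→rewrites derivation) (λ ()) (o-⊕ʳ o-var))
    where
    n : ℕ
    n = suc m
    U : Term A
    U = pow n (var x) ⊕ var x
    at-crossing : (Σ (Term A) λ t → Σ (Term A) λ t' → Rewrite E t t' × ¬ Unguarded x t ×
                   Unguarded x t' × Star (Rewrite E) t' U) → ⊥
    at-crossing (t , t' , st , ¬o , o' , rest) with crossing-step sound st ¬o o'
    ... | [] , o , _ = ¬o o
    ... | b ∷ π , o , le =
      no-shallow-occurrence n (sound t U (rewrites→derivation (st ◅ rest))) b π o (≤-trans (s≤s le) shallow)

module OneAction {A : Set} (a : A) (unique : ∀ b → b ≡ a) where

  open WithAction a

  private variable
    s p : Term A
    v : List A

  ∷≡∷ʳ : ∀ b v → b ∷ v ≡ v ++ b ∷ []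
  ∷≡∷ʳ b [] = refl
  ∷≡∷ʳ b (c ∷ v) = cong₂ _∷_ (≡-trans (unique b) (sym (unique c)))
                             (≡-trans (cong (_∷ v) (≡-trans (unique c) (sym (unique b)))) (∷≡∷ʳ b v))

  WT-act· : ∀ b → WT s v → WT (act b · s) v
  WT-act· {v = v} b (s' , r) =
    WT-prefix v (b ∷ []) (≡-subst (WT (act b · _)) (∷≡∷ʳ b v) (s' , step ε pre r))

  WT-pow : ∀ n → WT p v → WT (pow n p) v
  WT-pow zero wt = wt
  WT-pow (suc n) wt = WT-act· a (WT-pow n wt)

  valid : ∀ n p → pow n p ≾WIF (pow n p ⊕ p)
  valid n p = absorb (λ v → WT-pow n)

  family-derivable : ∀ {E} → GroundComplete E → OmegaComplete E →
    ∀ n → E ⊢ pow n (var 0) ≼ (pow n (var 0) ⊕ var 0)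
  family-derivable {E} ground-complete ω-complete n = ω-complete _ _ λ σ closed →
    subst₂ (E ⊢_≼_) (sym (pow-[] n (var 0) σ)) (cong (_⊕ σ 0) (sym (pow-[] n (var 0) σ)))
      (ground-complete _ _ (pow-closed n (closed 0)) (c⊕ (pow-closed n (closed 0)) (closed 0))
        (valid n (σ 0)))

theorem6p14 : (A : Set) → ExactlyOne A →
    ¬ (Σ (Axioms A) λ E → Sound E × GroundComplete E × OmegaComplete E)
theorem6p14 A (a , unique) (E , sound , ground-complete , ω-complete) =
  no-sound-derivation sound (family-derivable ground-complete ω-complete n) ≤-refl
  where
  open WithAction a using (no-sound-derivation)
  open OneAction a unique using (family-derivable)
  n : ℕ
  n = suc (lhs-depth E)
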